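{- Let \(w_1,w_2\) be integers with \(0 \leq w_1 \leq w_2\). The number of four-point multisets in \(\mathbb{Z}^2\) with multi-width \((w_1,w_2)\), up to affine unimodular equivalence, is at most \(\left(\frac{w_1^2}{4}+w_1+c\right)(6w_2^2+1)\), where \(c = 1\) if \(w_1\) is even and \(c = \frac34\) if \(w_1\) is odd.
   Context: A four-point set in \(\mathbb{Z}^2\) is a multiset of four lattice points. For \(u\in(\mathbb{Z}^2)^*\), its width with respect to \(u\) is \(\max_{s\in S}u\cdot s-\min_{s\in S}u\cdot s\); its multi-width is the lexicographically minimal pair \((\mathrm{width}_{u_1}(S),\mathrm{width}_{u_2}(S))\) over linearly independent \(u_1,u_2\in(\mathbb{Z}^2)^*\). Affine unimodular equivalence: maps \(x\mapsto Ax+b\), \(A\in\mathrm{GL}_2(\mathbb{Z})\), \(b\in\mathbb{Z}^2\). -}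

module Defs where

open import Data.Nat using (ℕ; zero; suc)
open import Data.Integer using (ℤ; +_; _+_; _-_; _*_; _⊔_; _⊓_; _<_; _≤_; -_)
open import Data.Product using (_×_; _,_; Σ; Σ-syntax; ∃; ∃-syntax)
open import Data.Sum using (_⊎_)
open import Data.Fin using (Fin; zero; suc)
open import Data.Fin.Permutation using (Permutation′; _⟨$⟩ʳ_)
open import Relation.Binary.PropositionalEquality using (_≡_; _≢_)

-- Lattice points / integer functionals in Z^2 (written as pairs (x , y)).
Point : Set
Point = ℤ × ℤ

-- An (ordered) 4-tuple of lattice points; the multiset is this tuple up to
-- reordering (see FourEquiv, which allows an arbitrary permutation).
FourSet : Set
FourSet = Fin 4 → Point

dot : Point → Point → ℤ
dot (a , b) (x , y) = a * x + b * y

max4 : (Fin 4 → ℤ) → ℤ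
max4 f = f zero ⊔ f (suc zero) ⊔ f (suc (suc zero)) ⊔ f (suc (suc (suc zero)))

min4 : (Fin 4 → ℤ) → ℤ
min4 f = f zero ⊓ f (suc zero) ⊓ f (suc (suc zero)) ⊓ f (suc (suc (suc zero)))

width : Point → FourSet → ℤ
width u S = max4 (λ i → dot u (S i)) - min4 (λ i → dot u (S i))

det : Point → Point → ℤ
det (a , b) (c , d) = a * d - b * c

LinIndep : Point → Point → Set
LinIndep u v = det u v ≢ + 0

LexLe : ℤ × ℤ → ℤ × ℤ → Set
LexLe (a , b) (c , d) = (a < c) ⊎ ((a ≡ c) × (b ≤ d))

HasMultiWidth : FourSet → ℕ → ℕ → Set
HasMultiWidth S w₁ w₂ =
  (Σ[ u₁ ∈ Point ] Σ[ u₂ ∈ Point ]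
     LinIndep u₁ u₂ × width u₁ S ≡ + w₁ × width u₂ S ≡ + w₂)
  × (∀ v₁ v₂ → LinIndep v₁ v₂ → LexLe (+ w₁ , + w₂) (width v₁ S , width v₂ S))

-- 2x2 integer matrix ((a , b) , (c , d)) with rows (a , b), (c , d)
Mat : Set
Mat = Point × Point

IsUnimodular : Mat → Set
IsUnimodular (r₁ , r₂) = (det r₁ r₂ ≡ + 1) ⊎ (det r₁ r₂ ≡ - (+ 1))

affine : Mat → Point → Point → Point
affine (r₁ , r₂) b p = (dot r₁ p + Data.Product.proj₁ b , dot r₂ p + Data.Product.proj₂ b)

FourEquiv : FourSet → FourSet → Set
FourEquiv S T = Σ[ A ∈ Mat ] Σ[ b ∈ Point ] Σ[ σ ∈ Permutation′ 4 ]
  IsUnimodular A × (∀ i → affine A b (S i) ≡ T (σ ⟨$⟩ʳ i))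

-- 4c, where c = 1 for w even and c = 3/4 for w odd
fourC : ℕ → ℕ
fourC zero = 4
fourC (suc zero) = 3
fourC (suc (suc n)) = fourC n

-- Take independent functionals u₁, u₂ realising the multi-width (w₁, w₂). Dividing u₁ by the gcd of its
-- entries and shearing u₂ along it gives a unimodular basis (p, v) whose widths are still at most w₁ and w₂,
-- hence exactly w₁ and w₂ by minimality. In the coordinates x = p·s − min p·S and y = v·s − min v·S the set
-- fills the box [0, w₁] × [0, w₂]. Permuting the points and reflecting x ↦ w₁ − x brings the x-coordinates to
-- (0, w₁, a, b) with a ≤ b and a + b ≤ w₁, leaving w₁²/4 + w₁ + c choices; independently, reflecting
-- y ↦ w₂ − y brings the y-coordinates to one of 6w₂² + 1 representatives.

module Submission where

open import Data.Fin using (Fin)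
open import Data.Fin.Patterns using (0F; 1F; 2F; 3F)
open import Data.Product using (Σ; ∃; ∃₂; _×_; _,_)
open import Data.Sum using (_⊎_; inj₁; inj₂)
open import Data.Empty using (⊥-elim)
open import Function using (_∘_; case_of_)
open import Relation.Binary.PropositionalEquality
open import Relation.Nullary using (yes; no; ¬_)
open import Defs

module Width where
  open import Data.Integer
  open import Data.Integer.Properties
  open import Data.Integer.Tactic.RingSolver using (solve-∀)

  max4-upperBound : ∀ (f : Fin 4 → ℤ) i → f i ≤ max4 f
  max4-upperBound f 0F = i≤j⇒i≤j⊔k _ (i≤j⇒i≤j⊔k _ (i≤i⊔j _ _))
  max4-upperBound f 1F = i≤j⇒i≤j⊔k _ (i≤j⇒i≤j⊔k _ (i≤j⊔i _ _))
  max4-upperBound f 2F = i≤j⇒i≤j⊔k _ (i≤j⊔i _ _)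
  max4-upperBound f 3F = i≤j⊔i _ _

  min4-lowerBound : ∀ (f : Fin 4 → ℤ) i → min4 f ≤ f i
  min4-lowerBound f 0F = i≤j⇒i⊓k≤j _ (i≤j⇒i⊓k≤j _ (i⊓j≤i _ _))
  min4-lowerBound f 1F = i≤j⇒i⊓k≤j _ (i≤j⇒i⊓k≤j _ (i⊓j≤j _ _))
  min4-lowerBound f 2F = i≤j⇒i⊓k≤j _ (i⊓j≤j _ _)
  min4-lowerBound f 3F = i⊓j≤j _ _

  max4-attained : ∀ (f : Fin 4 → ℤ) → ∃ λ i → max4 f ≡ f i
  max4-attained f with ⊔-sel (f 0F ⊔ f 1F ⊔ f 2F) (f 3F) | ⊔-sel (f 0F ⊔ f 1F) (f 2F) | ⊔-sel (f 0F) (f 1F)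
  ... | inj₂ e | _ | _ = 3F , e
  ... | inj₁ e | inj₂ e′ | _ = 2F , trans e e′
  ... | inj₁ e | inj₁ e′ | inj₁ e″ = 0F , trans e (trans e′ e″)
  ... | inj₁ e | inj₁ e′ | inj₂ e″ = 1F , trans e (trans e′ e″)

  min4-attained : ∀ (f : Fin 4 → ℤ) → ∃ λ i → min4 f ≡ f i
  min4-attained f with ⊓-sel (f 0F ⊓ f 1F ⊓ f 2F) (f 3F) | ⊓-sel (f 0F ⊓ f 1F) (f 2F) | ⊓-sel (f 0F) (f 1F)
  ... | inj₂ e | _ | _ = 3F , e
  ... | inj₁ e | inj₂ e′ | _ = 2F , trans e e′
  ... | inj₁ e | inj₁ e′ | inj₁ e″ = 0F , trans e (trans e′ e″)
  ... | inj₁ e | inj₁ e′ | inj₂ e″ = 1F , trans e (trans e′ e″)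

  spread : Point → FourSet → Fin 4 → Fin 4 → ℤ
  spread u S i j = dot u (S i) - dot u (S j)

  WidthAtMost : Point → FourSet → ℤ → Set
  WidthAtMost u S W = ∀ i j → spread u S i j ≤ W

  width-atMost : ∀ u S → WidthAtMost u S (width u S)
  width-atMost u S i j =
    +-mono-≤ (max4-upperBound (λ k → dot u (S k)) i) (neg-mono-≤ (min4-lowerBound (λ k → dot u (S k)) j))

  atMost⇒width≤ : ∀ {u S W} → WidthAtMost u S W → width u S ≤ W
  atMost⇒width≤ {u} {S} bound with max4-attained (λ k → dot u (S k)) | min4-attained (λ k → dot u (S k))
  ... | i , max≡ | j , min≡ rewrite max≡ | min≡ = bound i j

  infixl 6 _+ᵖ_
  infixl 7 _·ᵖ_

  _+ᵖ_ : Point → Point → Point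
  (a , b) +ᵖ (c , d) = (a + c , b + d)

  _·ᵖ_ : ℤ → Point → Point
  k ·ᵖ (a , b) = (k * a , k * b)

  spread-+ : ∀ u v S i j → spread (u +ᵖ v) S i j ≡ spread u S i j + spread v S i j
  spread-+ (a , b) (c , d) S i j with S i | S j
  ... | (x , y) | (x′ , y′) = lemma a b c d x y x′ y′
    where
    lemma : ∀ a b c d x y x′ y′ → ((a + c) * x + (b + d) * y) - ((a + c) * x′ + (b + d) * y′)
          ≡ ((a * x + b * y) - (a * x′ + b * y′)) + ((c * x + d * y) - (c * x′ + d * y′))
    lemma = solve-∀

  spread-· : ∀ k u S i j → spread (k ·ᵖ u) S i j ≡ k * spread u S i j
  spread-· k (a , b) S i j with S i | S j
  ... | (x , y) | (x′ , y′) = lemma k a b x y x′ y′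
    where
    lemma : ∀ k a b x y x′ y′ → ((k * a) * x + (k * b) * y) - ((k * a) * x′ + (k * b) * y′)
          ≡ k * ((a * x + b * y) - (a * x′ + b * y′))
    lemma = solve-∀

  spread-swap : ∀ u S i j → spread u S j i ≡ - spread u S i j
  spread-swap u S i j = lemma (dot u (S i)) (dot u (S j))
    where
    lemma : ∀ a b → b - a ≡ - (a - b)
    lemma = solve-∀

module PrimitiveVector where
  open import Data.Nat as ℕ using (ℕ; suc; NonZero)
  import Data.Nat.Properties as ℕ
  open import Data.Nat.Divisibility using (_∣_)
  open import Data.Nat.DivMod using (_/_; m/n*n≡m)
  open import Data.Nat.GCD using (gcd; gcd[m,n]∣m; gcd[m,n]∣n; gcd[m,n]≢0; module Bézout)
  open import Data.Nat.Coprimality using (coprime-/gcd; coprime-Bézout)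
  open import Data.Integer using (ℤ; +_; -[1+_]; +[1+_]; _+_; _-_; _*_; -_; ∣_∣; 0ℤ; 1ℤ; -1ℤ)
  open import Data.Integer.Properties using (pos-*; pos-+; +-comm; *-identityˡ; ∣i∣≡0⇒i≡0)
  open import Data.Integer.Tactic.RingSolver using (solve-∀)
  open Width

  coprime-factorisation : ∀ m n → m ≢ 0 ⊎ n ≢ 0 →
    ∃ λ g → ∃₂ λ m′ n′ → m ≡ m′ ℕ.* suc g × n ≡ n′ ℕ.* suc g × Bézout.Identity 1 m′ n′
  coprime-factorisation m n m≢0⊎n≢0 =
    ℕ.pred d , m / d , n / d , factor (gcd[m,n]∣m m n) , factor (gcd[m,n]∣n m n) , coprime-Bézout (coprime-/gcd m n)
    where
    d : ℕ
    d = gcd m n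
    instance
      d≢0 : NonZero d
      d≢0 = ℕ.≢-nonZero (gcd[m,n]≢0 m n m≢0⊎n≢0)
    factor : ∀ {k} → d ∣ k → k ≡ k / d ℕ.* suc (ℕ.pred d)
    factor {k} d∣k = trans (sym (m/n*n≡m d∣k)) (cong (k / d ℕ.*_) (sym (ℕ.suc-pred d)))

  integer-Bézout : ∀ {m n} → Bézout.Identity 1 m n → ∃₂ λ x y → x * + m + y * + n ≡ 1ℤ
  integer-Bézout {m} {n} (Bézout.+- x y eq) = + x , - + y , lemma x m y n eq
    where
    lemma : ∀ x m y n → 1 ℕ.+ y ℕ.* n ≡ x ℕ.* m → + x * + m + - + y * + n ≡ 1ℤ
    lemma x m y n eq = begin
      + x * + m + - + y * + n   ≡⟨ cong (_+ - + y * + n) (sym (pos-* x m)) ⟩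
      + (x ℕ.* m) + - + y * + n ≡⟨ cong (λ k → + k + - + y * + n) (sym eq) ⟩
      + (1 ℕ.+ y ℕ.* n) + - + y * + n
        ≡⟨ cong (_+ - + y * + n) (trans (pos-+ 1 (y ℕ.* n)) (cong (λ k → 1ℤ + k) (pos-* y n))) ⟩
      1ℤ + + y * + n + - + y * + n ≡⟨ cancel (+ y) (+ n) ⟩
      1ℤ ∎
      where
      open ≡-Reasoning
      cancel : ∀ a b → 1ℤ + a * b + - a * b ≡ 1ℤ
      cancel = solve-∀
  integer-Bézout {m} {n} (Bézout.-+ x y eq) with integer-Bézout (Bézout.+- y x eq)
  ... | y′ , x′ , eq′ = x′ , y′ , trans (+-comm (x′ * + m) (y′ * + n)) eq′

  signed-factor : ∀ a m g → ∣ a ∣ ≡ m ℕ.* suc g → ∃ λ s → a ≡ +[1+ g ] * (s * + m) × s * s ≡ 1ℤ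
  signed-factor (+ _) m g refl = 1ℤ , trans (pos-* m (suc g)) (lemma (+ m) +[1+ g ]) , refl
    where
    lemma : ∀ x k → x * k ≡ k * (1ℤ * x)
    lemma = solve-∀
  signed-factor -[1+ n ] m g eq =
    -1ℤ , trans (cong (λ k → - + k) eq) (trans (cong -_ (pos-* m (suc g))) (lemma (+ m) +[1+ g ])) , refl
    where
    lemma : ∀ x k → - (x * k) ≡ k * (-1ℤ * x)
    lemma = solve-∀

  primitive-factorisation : ∀ u → u ≢ (0ℤ , 0ℤ) →
    ∃ λ g → ∃₂ λ p q → u ≡ +[1+ g ] ·ᵖ p × det p q ≡ 1ℤ
  primitive-factorisation (a , b) u≢0 with coprime-factorisation ∣ a ∣ ∣ b ∣ nonzero
    where
    nonzero : ∣ a ∣ ≢ 0 ⊎ ∣ b ∣ ≢ 0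
    nonzero with ∣ a ∣ ℕ.≟ 0 | ∣ b ∣ ℕ.≟ 0
    ... | no ∣a∣≢0 | _ = inj₁ ∣a∣≢0
    ... | yes _ | no ∣b∣≢0 = inj₂ ∣b∣≢0
    ... | yes ∣a∣≡0 | yes ∣b∣≡0 =
      ⊥-elim (u≢0 (cong₂ _,_ (∣i∣≡0⇒i≡0 ∣a∣≡0) (∣i∣≡0⇒i≡0 ∣b∣≡0)))
  ... | g , m , n , ∣a∣≡ , ∣b∣≡ , identity
    with signed-factor a m g ∣a∣≡ | signed-factor b n g ∣b∣≡ | integer-Bézout identity
  ... | s , a≡ , s²≡1 | t , b≡ , t²≡1 | x , y , bézout =
    g , (s * + m , t * + n) , (- (t * y) , s * x) , cong₂ _,_ a≡ b≡ , det≡1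
    where
    det≡1 : det (s * + m , t * + n) (- (t * y) , s * x) ≡ 1ℤ
    det≡1 = begin
      s * + m * (s * x) - t * + n * - (t * y) ≡⟨ regroup s t (+ m) (+ n) x y ⟩
      (s * s) * (x * + m) + (t * t) * (y * + n)
        ≡⟨ cong₂ (λ σ τ → σ * (x * + m) + τ * (y * + n)) s²≡1 t²≡1 ⟩
      1ℤ * (x * + m) + 1ℤ * (y * + n)         ≡⟨ cong₂ _+_ (*-identityˡ (x * + m)) (*-identityˡ (y * + n)) ⟩
      x * + m + y * + n                         ≡⟨ bézout ⟩
      1ℤ ∎
      where
      open ≡-Reasoning
      regroup : ∀ s t m n x y → s * m * (s * x) - t * n * - (t * y) ≡ (s * s) * (x * m) + (t * t) * (y * n)
      regroup = solve-∀

module UnimodularBasis where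
  open import Data.Nat as ℕ using (ℕ; suc)
  import Data.Nat.Properties as ℕ
  open import Data.Integer using (ℤ; +0; +_; -[1+_]; +[1+_]; +≤+; -≤+; _+_; _-_; _*_; -_; _≤_; 0ℤ; 1ℤ; -1ℤ)
  open import Data.Integer.Properties
  open import Data.Integer.DivMod using (_/ℕ_; _%ℕ_; a≡a%ℕn+[a/ℕn]*n; n%ℕd<d)
  open import Data.Integer.Tactic.RingSolver using (solve-∀)
  open Width
  open PrimitiveVector

  det-·ˡ : ∀ k p u → det (k ·ᵖ p) u ≡ k * det p u
  det-·ˡ k (a , b) (c , d) = lemma k a b c d
    where
    lemma : ∀ k a b c d → k * a * d - k * b * c ≡ k * (a * d - b * c)
    lemma = solve-∀

  det-·ʳ : ∀ k p u → det p (k ·ᵖ u) ≡ k * det p u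
  det-·ʳ k (a , b) (c , d) = lemma k a b c d
    where
    lemma : ∀ k a b c d → a * (k * d) - b * (k * c) ≡ k * (a * d - b * c)
    lemma = solve-∀

  det-shear : ∀ k p q → det p (q +ᵖ k ·ᵖ p) ≡ det p q
  det-shear k (a , b) (c , d) = lemma k a b c d
    where
    lemma : ∀ k a b c d → a * (d + k * b) - b * (c + k * a) ≡ a * d - b * c
    lemma = solve-∀

  cramer : ∀ p q u → det u q ·ᵖ p +ᵖ det p u ·ᵖ q ≡ det p q ·ᵖ u
  cramer (a , b) (c , d) (x , y) = cong₂ _,_ (first a b c d x y) (second a b c d x y)
    where
    first : ∀ a b c d x y → (x * d - y * c) * a + (a * y - b * x) * c ≡ (a * d - b * c) * x
    first = solve-∀
    second : ∀ a b c d x y → (x * d - y * c) * b + (a * y - b * x) * d ≡ (a * d - b * c) * y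
    second = solve-∀

  spread-cramer : ∀ p q u S i j →
    det p q * spread u S i j ≡ det u q * spread p S i j + det p u * spread q S i j
  spread-cramer p q u S i j = begin
    det p q * spread u S i j                          ≡⟨ spread-· (det p q) u S i j ⟨
    spread (det p q ·ᵖ u) S i j                       ≡⟨ cong (λ w → spread w S i j) (cramer p q u) ⟨
    spread (det u q ·ᵖ p +ᵖ det p u ·ᵖ q) S i j         ≡⟨ spread-+ (det u q ·ᵖ p) (det p u ·ᵖ q) S i j ⟩
    spread (det u q ·ᵖ p) S i j + spread (det p u ·ᵖ q) S i j
      ≡⟨ cong₂ _+_ (spread-· (det u q) p S i j) (spread-· (det p u) q S i j) ⟩
    det u q * spread p S i j + det p u * spread q S i j ∎
    where open ≡-Reasoning

  -- With v = q + k p and k = ⌊det(u, q) / t⌋ one gets t v = u − r p for some 0 ≤ r < t, so that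
  -- t · width v ≤ w₂ + r w₁ ≤ t w₂.
  unimodular-completion⁺ : ∀ {S p q u T w₁ w₂} → det p q ≡ 1ℤ → det p u ≡ +[1+ T ] → w₁ ℕ.≤ w₂ →
    WidthAtMost p S (+ w₁) → WidthAtMost u S (+ w₂) → ∃ λ v → det p v ≡ 1ℤ × WidthAtMost v S (+ w₂)
  unimodular-completion⁺ {S} {p} {q} {u} {T} {w₁} {w₂} pq≡1 pu≡t w₁≤w₂ p≤w₁ u≤w₂ =
    v , trans (det-shear k p q) pq≡1 , v≤w₂
    where
    t s k : ℤ
    t = +[1+ T ]
    s = det u q
    k = s /ℕ suc T
    r : ℕ
    r = s %ℕ suc T
    v : Point
    v = q +ᵖ k ·ᵖ p

    scaled : ∀ i j → t * spread v S i j ≡ spread u S i j + + r * spread p S j i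
    scaled i j = begin
      t * spread v S i j
        ≡⟨ cong (t *_) (trans (spread-+ q (k ·ᵖ p) S i j) (cong (λ z → Q + z) (spread-· k p S i j))) ⟩
      t * (Q + k * P)                   ≡⟨ regroup t k (+ r) P Q ⟩
      ((+ r + k * t) * P + t * Q) + + r * - P ≡⟨ cong (_+ + r * - P) (sym in-basis) ⟩
      1ℤ * U + + r * - P                 ≡⟨ cong₂ _+_ (*-identityˡ U) (cong (+ r *_) (sym (spread-swap p S i j))) ⟩
      U + + r * spread p S j i ∎
      where
      open ≡-Reasoning
      P Q U : ℤ
      P = spread p S i j
      Q = spread q S i j
      U = spread u S i j
      in-basis : 1ℤ * U ≡ (+ r + k * t) * P + t * Q
      in-basis = trans (cong (_* U) (sym pq≡1))
        (trans (spread-cramer p q u S i j) (cong₂ (λ a b → a * P + b * Q) (a≡a%ℕn+[a/ℕn]*n s (suc T)) pu≡t))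
      regroup : ∀ t k r P Q → t * (Q + k * P) ≡ ((r + k * t) * P + t * Q) + r * - P
      regroup = solve-∀

    v≤w₂ : WidthAtMost v S (+ w₂)
    v≤w₂ i j = *-cancelˡ-≤-pos (spread v S i j) (+ w₂) t (begin
      t * spread v S i j                   ≡⟨ scaled i j ⟩
      spread u S i j + + r * spread p S j i ≤⟨ +-mono-≤ (u≤w₂ i j) (*-monoˡ-≤-nonNeg (+ r) (p≤w₁ j i)) ⟩
      + w₂ + + r * + w₁                    ≤⟨ +-monoʳ-≤ (+ w₂) r*w₁≤T*w₂ ⟩
      + w₂ + + (T ℕ.* w₂)                  ≡⟨ pos-+ w₂ (T ℕ.* w₂) ⟨
      + (suc T ℕ.* w₂)                     ≡⟨ pos-* (suc T) w₂ ⟩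
      t * + w₂ ∎)
      where
      open ≤-Reasoning
      r*w₁≤T*w₂ : + r * + w₁ ≤ + (T ℕ.* w₂)
      r*w₁≤T*w₂ =
        ≤-trans (≤-reflexive (sym (pos-* r w₁))) (+≤+ (ℕ.*-mono-≤ (ℕ.≤-pred (n%ℕd<d s (suc T))) w₁≤w₂))

  +[1+g]*i≤+n⇒i≤+n : ∀ g i n → +[1+ g ] * i ≤ + n → i ≤ + n
  +[1+g]*i≤+n⇒i≤+n g (+ m) n gm≤n =
    ≤-trans (+≤+ (ℕ.m≤m+n m (g ℕ.* m))) (≤-trans (≤-reflexive (pos-* (suc g) m)) gm≤n)
  +[1+g]*i≤+n⇒i≤+n g -[1+ m ] n _ = -≤+

  WidthAtMost-unscale : ∀ {S g p w} → WidthAtMost (+[1+ g ] ·ᵖ p) S (+ w) → WidthAtMost p S (+ w)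
  WidthAtMost-unscale {S} {g} {p} {w} gp≤w i j =
    +[1+g]*i≤+n⇒i≤+n g (spread p S i j) w (≤-trans (≤-reflexive (sym (spread-· +[1+ g ] p S i j))) (gp≤w i j))

  WidthAtMost-neg : ∀ {S u W} → WidthAtMost u S W → WidthAtMost (-1ℤ ·ᵖ u) S W
  WidthAtMost-neg {S} {u} {W} u≤W i j = begin
    spread (-1ℤ ·ᵖ u) S i j ≡⟨ spread-· -1ℤ u S i j ⟩
    -1ℤ * spread u S i j    ≡⟨ -1*i≡-i (spread u S i j) ⟩
    - spread u S i j        ≡⟨ spread-swap u S i j ⟨
    spread u S j i          ≤⟨ u≤W j i ⟩
    W ∎
    where open ≤-Reasoning

  det-zeroˡ : ∀ u → det (0ℤ , 0ℤ) u ≡ 0ℤ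
  det-zeroˡ (c , d) = refl

  unimodular-completion : ∀ {S p q u w₁ w₂} → det p q ≡ 1ℤ → det p u ≢ 0ℤ → w₁ ℕ.≤ w₂ →
    WidthAtMost p S (+ w₁) → WidthAtMost u S (+ w₂) → ∃ λ v → det p v ≡ 1ℤ × WidthAtMost v S (+ w₂)
  unimodular-completion {S} {p} {q} {u} pq≡1 pu≢0 w₁≤w₂ p≤w₁ u≤w₂ with det p u in pu≡d
  ... | +0 = ⊥-elim (pu≢0 refl)
  ... | +[1+ T ] = unimodular-completion⁺ {S} {p} {q} {u} pq≡1 pu≡d w₁≤w₂ p≤w₁ u≤w₂
  ... | -[1+ T ] =
    unimodular-completion⁺ {S} {p} {q} { -1ℤ ·ᵖ u } pq≡1 p[-u]≡1+T w₁≤w₂ p≤w₁ (WidthAtMost-neg {S} {u} u≤w₂)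
    where
    p[-u]≡1+T : det p (-1ℤ ·ᵖ u) ≡ +[1+ T ]
    p[-u]≡1+T = trans (det-·ʳ -1ℤ p u) (trans (-1*i≡-i (det p u)) (cong -_ pu≡d))

  unimodular-basis : ∀ {S u₁ u₂ w₁ w₂} → LinIndep u₁ u₂ → w₁ ℕ.≤ w₂ →
    WidthAtMost u₁ S (+ w₁) → WidthAtMost u₂ S (+ w₂) →
    ∃₂ λ p v → det p v ≡ 1ℤ × WidthAtMost p S (+ w₁) × WidthAtMost v S (+ w₂)
  unimodular-basis {S} {u₁} {u₂} {w₁} {w₂} indep w₁≤w₂ u₁≤w₁ u₂≤w₂ =
    from-primitive (primitive-factorisation u₁ λ u₁≡0 →
      indep (trans (cong (λ z → det z u₂) u₁≡0) (det-zeroˡ u₂)))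
    where
    from-primitive : (∃ λ g → ∃₂ λ p q → u₁ ≡ +[1+ g ] ·ᵖ p × det p q ≡ 1ℤ) →
      ∃₂ λ p v → det p v ≡ 1ℤ × WidthAtMost p S (+ w₁) × WidthAtMost v S (+ w₂)
    from-primitive (g , p , q , u₁≡gp , pq≡1) =
      extend (unimodular-completion {S} {p} {q} {u₂} pq≡1 pu₂≢0 w₁≤w₂ p≤w₁ u₂≤w₂)
      where
      p≤w₁ : WidthAtMost p S (+ w₁)
      p≤w₁ = WidthAtMost-unscale {S} {g} {p} (subst (λ z → WidthAtMost z S (+ w₁)) u₁≡gp u₁≤w₁)
      pu₂≢0 : det p u₂ ≢ 0ℤ
      pu₂≢0 pu₂≡0 = indep (begin
        det u₁ u₂                  ≡⟨ cong (λ z → det z u₂) u₁≡gp ⟩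
        det (+[1+ g ] ·ᵖ p) u₂     ≡⟨ det-·ˡ +[1+ g ] p u₂ ⟩
        +[1+ g ] * det p u₂        ≡⟨ cong (+[1+ g ] *_) pu₂≡0 ⟩
        +[1+ g ] * 0ℤ              ≡⟨ *-zeroʳ +[1+ g ] ⟩
        0ℤ ∎)
        where open ≡-Reasoning
      extend : (∃ λ v → det p v ≡ 1ℤ × WidthAtMost v S (+ w₂)) →
        ∃₂ λ p v → det p v ≡ 1ℤ × WidthAtMost p S (+ w₁) × WidthAtMost v S (+ w₂)
      extend (v , pv≡1 , v≤w₂) = p , v , pv≡1 , p≤w₁ , v≤w₂

module Equivalence where
  open import Data.Nat as ℕ using (ℕ; _∸_)
  open import Data.Integer using (ℤ; +_; _+_; _-_; _*_; -_; 0ℤ; 1ℤ; -1ℤ)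
  open import Data.Integer.Properties using (m-n≡m⊖n; ⊖-≥)
  open import Data.Integer.Tactic.RingSolver using (solve-∀)
  open import Data.Fin.Permutation as Perm using (Permutation′; _⟨$⟩ʳ_; _∘ₚ_)

  infixl 7 _⊗_

  _⊗_ : Mat → Mat → Mat
  ((a , b) , (c , d)) ⊗ ((a′ , b′) , (c′ , d′)) =
    ((a * a′ + b * c′ , a * b′ + b * d′) , (c * a′ + d * c′ , c * b′ + d * d′))

  detM : Mat → ℤ
  detM (r₁ , r₂) = det r₁ r₂

  detM-⊗ : ∀ A B → detM (A ⊗ B) ≡ detM A * detM B
  detM-⊗ ((a , b) , (c , d)) ((a′ , b′) , (c′ , d′)) = lemma a b c d a′ b′ c′ d′
    where
    lemma : ∀ a b c d a′ b′ c′ d′ →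
      (a * a′ + b * c′) * (c * b′ + d * d′) - (a * b′ + b * d′) * (c * a′ + d * c′)
      ≡ (a * d - b * c) * (a′ * d′ - b′ * c′)
    lemma = solve-∀

  unimodular-⊗ : ∀ A B → IsUnimodular A → IsUnimodular B → IsUnimodular (A ⊗ B)
  unimodular-⊗ A B uA uB rewrite detM-⊗ A B with uA | uB
  ... | inj₁ eA | inj₁ eB rewrite eA | eB = inj₁ refl
  ... | inj₁ eA | inj₂ eB rewrite eA | eB = inj₂ refl
  ... | inj₂ eA | inj₁ eB rewrite eA | eB = inj₂ refl
  ... | inj₂ eA | inj₂ eB rewrite eA | eB = inj₁ refl

  affine-∘ : ∀ A b B c x → affine A b (affine B c x) ≡ affine (A ⊗ B) (affine A b c) x
  affine-∘ ((a , b) , (c , d)) (e , f) ((a′ , b′) , (c′ , d′)) (e′ , f′) (x , y) =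
    cong₂ _,_ (lemma a b a′ b′ c′ d′ e′ f′ e x y) (lemma c d a′ b′ c′ d′ e′ f′ f x y)
    where
    lemma : ∀ a b a′ b′ c′ d′ e′ f′ e x y →
      a * (a′ * x + b′ * y + e′) + b * (c′ * x + d′ * y + f′) + e ≡
      (a * a′ + b * c′) * x + (a * b′ + b * d′) * y + (a * e′ + b * f′ + e)
    lemma = solve-∀

  identityM : Mat
  identityM = ((1ℤ , 0ℤ) , (0ℤ , 1ℤ))

  affine-identity : ∀ x → affine identityM (0ℤ , 0ℤ) x ≡ x
  affine-identity (x , y) = cong₂ _,_ (first x y) (second x y)
    where
    first : ∀ x y → 1ℤ * x + 0ℤ * y + 0ℤ ≡ x
    first = solve-∀
    second : ∀ x y → 0ℤ * x + 1ℤ * y + 0ℤ ≡ y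
    second = solve-∀

  FourEquiv-pointwise : ∀ {S T : FourSet} → (∀ i → S i ≡ T i) → FourEquiv S T
  FourEquiv-pointwise {S} S≗T =
    identityM , (0ℤ , 0ℤ) , Perm.id , inj₁ refl , λ i → trans (affine-identity (S i)) (S≗T i)

  FourEquiv-permute : ∀ (S : FourSet) (π : Permutation′ 4) → FourEquiv S (S ∘ (π ⟨$⟩ʳ_))
  FourEquiv-permute S π =
    identityM , (0ℤ , 0ℤ) , Perm.flip π , inj₁ refl ,
    λ i → trans (affine-identity (S i)) (cong S (sym (Perm.inverseʳ π)))

  FourEquiv-affine : ∀ {S T : FourSet} A b → IsUnimodular A → (∀ i → affine A b (S i) ≡ T i) → FourEquiv S T
  FourEquiv-affine A b unimodular AS+b≗T = A , b , Perm.id , unimodular , AS+b≗T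

  FourEquiv-trans : ∀ {S T U : FourSet} → FourEquiv S T → FourEquiv T U → FourEquiv S U
  FourEquiv-trans {S} (A , b , σ , uA , ST) (B , c , τ , uB , TU) =
    B ⊗ A , affine B c b , σ ∘ₚ τ , unimodular-⊗ B A uB uA ,
    λ i → trans (sym (affine-∘ B c A b (S i))) (trans (cong (affine B c) (ST i)) (TU (σ ⟨$⟩ʳ i)))

  grid : (Fin 4 → ℕ) → (Fin 4 → ℕ) → FourSet
  grid xs ys i = (+ xs i , + ys i)

  +m-+n≡+[m∸n] : ∀ {m n} → n ℕ.≤ m → + m - + n ≡ + (m ∸ n)
  +m-+n≡+[m∸n] {m} {n} n≤m = trans (m-n≡m⊖n m n) (⊖-≥ n≤m)

  grid-reflectˣ : ∀ {w} xs ys → (∀ i → xs i ℕ.≤ w) → FourEquiv (grid xs ys) (grid (λ i → w ∸ xs i) ys)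
  grid-reflectˣ {w} xs ys xs≤w = FourEquiv-affine ((-1ℤ , 0ℤ) , (0ℤ , 1ℤ)) (+ w , 0ℤ) (inj₂ refl)
    λ i → cong₂ _,_ (trans (first (+ xs i) (+ ys i) (+ w)) (+m-+n≡+[m∸n] (xs≤w i))) (second (+ xs i) (+ ys i))
    where
    first : ∀ x y w → -1ℤ * x + 0ℤ * y + w ≡ w - x
    first = solve-∀
    second : ∀ x y → 0ℤ * x + 1ℤ * y + 0ℤ ≡ y
    second = solve-∀

  grid-reflectʸ : ∀ {w} xs ys → (∀ i → ys i ℕ.≤ w) → FourEquiv (grid xs ys) (grid xs (λ i → w ∸ ys i))
  grid-reflectʸ {w} xs ys ys≤w = FourEquiv-affine ((1ℤ , 0ℤ) , (0ℤ , -1ℤ)) (0ℤ , + w) (inj₂ refl)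
    λ i → cong₂ _,_ (first (+ xs i) (+ ys i)) (trans (second (+ xs i) (+ ys i) (+ w)) (+m-+n≡+[m∸n] (ys≤w i)))
    where
    first : ∀ x y → 1ℤ * x + 0ℤ * y + 0ℤ ≡ x
    first = solve-∀
    second : ∀ x y w → 0ℤ * x + -1ℤ * y + w ≡ w - y
    second = solve-∀

module Pairs where
  open import Data.Nat
  open import Data.Nat.Properties using (+-suc)
  open import Data.Nat.Tactic.RingSolver using (solve-∀)
  open import Data.List using (List; []; _∷_; _++_; map; length; upTo)
  open import Data.List.Properties using (length-++; length-map; length-upTo)
  open import Data.List.Membership.Propositional using (_∈_)
  open import Data.List.Membership.Propositional.Properties using (∈-++⁺ˡ; ∈-++⁺ʳ; ∈-map⁺; ∈-upTo⁺)
  open import Data.List.Relation.Unary.Any using (here; there)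

  shift : ℕ × ℕ → ℕ × ℕ
  shift (a , b) = (suc a , suc b)

  onAxis : ℕ → ℕ × ℕ
  onAxis b = (0 , b)

  pairs : ℕ → List (ℕ × ℕ)
  pairs zero = (0 , 0) ∷ []
  pairs (suc zero) = (0 , 0) ∷ (0 , 1) ∷ []
  pairs (suc (suc w)) = map shift (pairs w) ++ map onAxis (upTo (3 + w))

  length-pairs : ∀ w → 4 * length (pairs w) ≡ w * w + 4 * w + fourC w
  length-pairs zero = refl
  length-pairs (suc zero) = refl
  length-pairs (suc (suc w)) = begin
    4 * length (pairs (2 + w))
      ≡⟨ cong (4 *_) (length-++ (map shift (pairs w))) ⟩
    4 * (length (map shift (pairs w)) + length (map onAxis (upTo (3 + w))))
      ≡⟨ cong₂ (λ m n → 4 * (m + n)) (length-map shift (pairs w))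
               (trans (length-map onAxis (upTo (3 + w))) (length-upTo (3 + w))) ⟩
    4 * (length (pairs w) + (3 + w))   ≡⟨ distribute (length (pairs w)) w ⟩
    4 * length (pairs w) + (4 * w + 12) ≡⟨ cong (_+ (4 * w + 12)) (length-pairs w) ⟩
    w * w + 4 * w + fourC w + (4 * w + 12) ≡⟨ complete-square w (fourC w) ⟩
    (2 + w) * (2 + w) + 4 * (2 + w) + fourC w ∎
    where
    open ≡-Reasoning
    distribute : ∀ l w → 4 * (l + (3 + w)) ≡ 4 * l + (4 * w + 12)
    distribute = solve-∀
    complete-square : ∀ w c → w * w + 4 * w + c + (4 * w + 12) ≡ (2 + w) * (2 + w) + 4 * (2 + w) + c
    complete-square = solve-∀

  ∈-pairs : ∀ w {a b} → a ≤ b → a + b ≤ w → (a , b) ∈ pairs w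
  ∈-pairs zero z≤n z≤n = here refl
  ∈-pairs (suc zero) {zero} {zero} _ _ = here refl
  ∈-pairs (suc zero) {zero} {suc zero} _ _ = there (here refl)
  ∈-pairs (suc zero) {zero} {suc (suc b)} _ (s≤s ())
  ∈-pairs (suc zero) {suc a} {suc b} (s≤s a≤b) (s≤s a+1+b≤0) rewrite +-suc a b with a+1+b≤0
  ... | ()
  ∈-pairs (suc (suc w)) {zero} _ b≤2+w = ∈-++⁺ʳ _ (∈-map⁺ onAxis (∈-upTo⁺ (s≤s b≤2+w)))
  ∈-pairs (suc (suc w)) {suc a} {suc b} (s≤s a≤b) (s≤s a+1+b≤1+w) rewrite +-suc a b with a+1+b≤1+w
  ... | s≤s a+b≤w = ∈-++⁺ˡ (∈-map⁺ shift (∈-pairs w a≤b a+b≤w))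

module Profiles where
  open import Data.Nat
  open import Data.Nat.Properties
    using (*-cancelˡ-≡; +-cancelʳ-≡; >⇒≢; ≤∧≢⇒<; m∸n≤m; n∸n≡0; ∸-monoʳ-<; m<n⇒0<n∸m; n≢0⇒n>0)
  open import Data.Nat.Tactic.RingSolver using (solve-∀)
  open import Data.List using (List; []; _∷_; _++_; map; length; upTo; applyUpTo; cartesianProductWith)
  open import Data.List.Properties using (length-++; length-map; length-upTo; length-applyUpTo)
  open import Data.List.Membership.Propositional using (_∈_)
  open import Data.List.Membership.Propositional.Properties
    using (∈-++⁺ˡ; ∈-++⁺ʳ; ∈-map⁺; ∈-upTo⁺; ∈-applyUpTo⁺; ∈-cartesianProductWith⁺)
  open import Data.List.Relation.Unary.Any using (here)
  open import Data.Vec as Vec using (Vec; []; _∷_)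
  open import Data.Vec.Relation.Unary.All as All using (All; []; _∷_)
  import Data.Vec.Relation.Unary.Any as Anyᵥ
  open import Data.Vec.Membership.Propositional renaming (_∈_ to _∈ᵥ_)
  open import Data.Vec.Membership.Propositional.Properties using () renaming (∈-map⁺ to ∈ᵥ-map⁺)
  import Data.Vec.Relation.Unary.All.Properties as All

  length-cartesianProductWith : ∀ {A B C : Set} (f : A → B → C) xs ys →
    length (cartesianProductWith f xs ys) ≡ length xs * length ys
  length-cartesianProductWith f [] ys = refl
  length-cartesianProductWith f (x ∷ xs) ys =
    trans (length-++ (map (f x) ys)) (cong₂ _+_ (length-map (f x) ys) (length-cartesianProductWith f xs ys))

  module _ (n : ℕ) where

    tuples : ∀ k → List (Vec ℕ k)
    tuples zero = [] ∷ []
    tuples (suc k) = cartesianProductWith _∷_ (upTo (suc n)) (tuples k)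

    reaching : ∀ k → List (Vec ℕ k)
    reaching zero = []
    reaching (suc k) = map (n ∷_) (tuples k) ++ cartesianProductWith _∷_ (upTo n) (reaching k)

    -- Tuples in [0, n]ᵏ containing both 0 and n whose first entry in {0, n} is 0: one from each orbit of
    -- t ↦ n − t. Likewise `reaching k` lists the tuples containing n.
    profiles : ∀ k → List (Vec ℕ k)
    profiles zero = []
    profiles (suc k) = map (0 ∷_) (reaching k) ++ cartesianProductWith _∷_ (applyUpTo suc (n ∸ 1)) (profiles k)

    length-tuples : ∀ k → length (tuples k) ≡ suc n ^ k
    length-tuples zero = refl
    length-tuples (suc k) = trans (length-cartesianProductWith _∷_ (upTo (suc n)) (tuples k))
      (cong₂ _*_ (length-upTo (suc n)) (length-tuples k))

    length-reaching-suc : ∀ k → length (reaching (suc k)) ≡ suc n ^ k + n * length (reaching k)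
    length-reaching-suc k = trans (length-++ (map (n ∷_) (tuples k)))
      (cong₂ _+_ (trans (length-map (n ∷_) (tuples k)) (length-tuples k))
                 (trans (length-cartesianProductWith _∷_ (upTo n) (reaching k))
                        (cong (_* length (reaching k)) (length-upTo n))))

    length-profiles-suc : ∀ k → length (profiles (suc k)) ≡ length (reaching k) + (n ∸ 1) * length (profiles k)
    length-profiles-suc k = trans (length-++ (map (0 ∷_) (reaching k)))
      (cong₂ _+_ (length-map (0 ∷_) (reaching k))
                 (trans (length-cartesianProductWith _∷_ (applyUpTo suc (n ∸ 1)) (profiles k))
                        (cong (_* length (profiles k)) (length-applyUpTo suc (n ∸ 1)))))

    length-reaching : ∀ k → length (reaching k) + n ^ k ≡ suc n ^ k
    length-reaching zero = refl
    length-reaching (suc k) = begin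
      length (reaching (suc k)) + n ^ suc k            ≡⟨ cong (_+ n ^ suc k) (length-reaching-suc k) ⟩
      suc n ^ k + n * length (reaching k) + n * n ^ k  ≡⟨ regroup (suc n ^ k) n (length (reaching k)) (n ^ k) ⟩
      suc n ^ k + n * (length (reaching k) + n ^ k)    ≡⟨ cong (λ z → suc n ^ k + n * z) (length-reaching k) ⟩
      suc n ^ k + n * suc n ^ k ∎
      where
      open ≡-Reasoning
      regroup : ∀ a n r b → a + n * r + n * b ≡ a + n * (r + b)
      regroup = solve-∀

  length-profiles : ∀ m k → 2 * length (profiles (suc m) k) + 2 * suc m ^ k ≡ suc (suc m) ^ k + m ^ k
  length-profiles m zero = refl
  length-profiles m (suc k) = begin
    2 * length (profiles n (suc k)) + 2 * (n * n ^ k)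
      ≡⟨ cong (λ z → 2 * z + 2 * (n * n ^ k)) (length-profiles-suc n k) ⟩
    2 * (r + m * p) + 2 * (n * n ^ k)                  ≡⟨ regroup m r p (n ^ k) ⟩
    2 * (r + n ^ k) + m * (2 * p + 2 * n ^ k)
      ≡⟨ cong₂ (λ a b → 2 * a + m * b) (length-reaching n k) (length-profiles m k) ⟩
    2 * suc n ^ k + m * (suc n ^ k + m ^ k)            ≡⟨ collect m (suc n ^ k) (m ^ k) ⟩
    suc n * suc n ^ k + m * m ^ k ∎
    where
    open ≡-Reasoning
    n r p : ℕ
    n = suc m
    r = length (reaching n k)
    p = length (profiles n k)
    regroup : ∀ m r p a → 2 * (r + m * p) + 2 * (suc m * a) ≡ 2 * (r + a) + m * (2 * p + 2 * a)
    regroup = solve-∀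
    collect : ∀ m b c → 2 * b + m * (b + c) ≡ suc (suc m) * b + m * c
    collect = solve-∀

  length-profiles-4 : ∀ n → length (profiles n 4) ≡ 6 * (n * n) + 1
  length-profiles-4 zero = refl
  length-profiles-4 (suc m) = *-cancelˡ-≡ (length (profiles (suc m) 4)) (6 * (suc m * suc m) + 1) 2
    (+-cancelʳ-≡ (2 * suc m ^ 4) _ _ (trans (length-profiles m 4) (quartic m)))
    where
    quartic : ∀ m → (2 + m) * ((2 + m) * ((2 + m) * ((2 + m) * 1))) + m * (m * (m * (m * 1)))
                  ≡ 2 * (6 * ((1 + m) * (1 + m)) + 1) + 2 * ((1 + m) * ((1 + m) * ((1 + m) * ((1 + m) * 1))))
    quartic = solve-∀

  reflect : ∀ {k} → ℕ → Vec ℕ k → Vec ℕ k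
  reflect n = Vec.map (n ∸_)

  tuples-complete : ∀ {n k} {t : Vec ℕ k} → All (_≤ n) t → t ∈ tuples n k
  tuples-complete [] = here refl
  tuples-complete (y≤n ∷ t≤n) = ∈-cartesianProductWith⁺ _∷_ (∈-upTo⁺ (s≤s y≤n)) (tuples-complete t≤n)

  reaching-complete : ∀ {n k} {t : Vec ℕ k} → All (_≤ n) t → n ∈ᵥ t → t ∈ reaching n k
  reaching-complete {n} {t = y ∷ t} (y≤n ∷ t≤n) n∈y∷t with y ≟ n
  ... | yes refl = ∈-++⁺ˡ (∈-map⁺ (n ∷_) (tuples-complete t≤n))
  ... | no y≢n = ∈-++⁺ʳ _ (∈-cartesianProductWith⁺ _∷_ (∈-upTo⁺ (≤∧≢⇒< y≤n y≢n))
                   (reaching-complete t≤n (Anyᵥ.tail (y≢n ∘ sym) n∈y∷t)))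

  ∈-interior : ∀ {n y} → 0 < y → y < n → y ∈ applyUpTo suc (n ∸ 1)
  ∈-interior {suc n} {suc y} _ (s≤s y<n) = ∈-applyUpTo⁺ suc y<n

  reflect-bounded : ∀ {n k} (t : Vec ℕ k) → All (_≤ n) (reflect n t)
  reflect-bounded {n} t = All.map⁺ (All.universal (m∸n≤m n) t)

  profiles-complete : ∀ {n k} {t : Vec ℕ k} → 0 < n → All (_≤ n) t → 0 ∈ᵥ t → n ∈ᵥ t →
    t ∈ profiles n k ⊎ reflect n t ∈ profiles n k
  profiles-complete {n} {t = y ∷ t} 0<n (y≤n ∷ t≤n) 0∈y∷t n∈y∷t with y ≟ 0 | y ≟ n
  ... | yes refl | _ =
    inj₁ (∈-++⁺ˡ (∈-map⁺ (0 ∷_) (reaching-complete t≤n (Anyᵥ.tail (>⇒≢ 0<n) n∈y∷t))))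
  ... | no y≢0 | yes refl rewrite n∸n≡0 n =
    inj₂ (∈-++⁺ˡ (∈-map⁺ (0 ∷_)
      (reaching-complete (reflect-bounded t) (∈ᵥ-map⁺ (n ∸_) (Anyᵥ.tail (y≢0 ∘ sym) 0∈y∷t)))))
  ... | no y≢0 | no y≢n
    with profiles-complete 0<n t≤n (Anyᵥ.tail (y≢0 ∘ sym) 0∈y∷t) (Anyᵥ.tail (y≢n ∘ sym) n∈y∷t)
  ...   | inj₁ t∈ = inj₁ (∈-++⁺ʳ _ (∈-cartesianProductWith⁺ _∷_ (∈-interior (n≢0⇒n>0 y≢0) y<n) t∈))
    where
    y<n : y < n
    y<n = ≤∧≢⇒< y≤n y≢n
  ...   | inj₂ t′∈ = inj₂ (∈-++⁺ʳ _ (∈-cartesianProductWith⁺ _∷_ (∈-interior 0<n∸y n∸y<n) t′∈))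
    where
    0<n∸y : 0 < n ∸ y
    0<n∸y = m<n⇒0<n∸m (≤∧≢⇒< y≤n y≢n)
    n∸y<n : n ∸ y < n
    n∸y<n = ∸-monoʳ-< (n≢0⇒n>0 y≢0) y≤n

  -- For n = 0 profiles-complete fails on the tuple 0 ∷ [], whence its hypothesis 0 < n.
  profiles-complete-4 : ∀ n {t : Vec ℕ 4} → All (_≤ n) t → 0 ∈ᵥ t → n ∈ᵥ t →
    t ∈ profiles n 4 ⊎ reflect n t ∈ profiles n 4
  profiles-complete-4 zero (z≤n ∷ z≤n ∷ z≤n ∷ z≤n ∷ []) _ _ = inj₁ (here refl)
  profiles-complete-4 (suc n) = profiles-complete (s≤s z≤n)

module NormalForms where
  open import Data.Nat
  open import Data.Nat.Properties
    using (_≤?_; +-comm; ≰⇒>; <⇒≤; n∸n≡0; m≤n+o⇒m∸n≤o; m∸n+n≡m; +-monoʳ-≤; ≤-trans; ≤-reflexive; n≤0⇒n≡0)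
  open import Data.Integer using (+_)
  import Data.Fin.Properties as Fin
  open import Data.Fin.Permutation as Perm using (Permutation′; _⟨$⟩ʳ_; _⟨$⟩ˡ_; _∘ₚ_; transpose)
  open import Data.List.Membership.Propositional using (_∈_)
  open import Data.Vec using ([]; _∷_; lookup; tabulate)
  open import Data.Vec.Properties using (lookup∘tabulate; lookup-map)
  open import Data.Vec.Membership.Propositional using () renaming (_∈_ to _∈ᵥ_)
  open import Data.Vec.Membership.Propositional.Properties using (∈-tabulate⁺)
  open import Data.Vec.Relation.Unary.All.Properties using (tabulate⁺)
  open Equivalence
  open Pairs
  open Profiles

  Fills : ℕ → (Fin 4 → ℕ) → Set
  Fills w xs = (∀ i → xs i ≤ w) × (∃ λ i → xs i ≡ 0) × (∃ λ i → xs i ≡ w)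

  Fills-permute : ∀ {w xs} (π : Permutation′ 4) → Fills w xs → Fills w (xs ∘ (π ⟨$⟩ʳ_))
  Fills-permute {xs = xs} π (xs≤w , (i , xsi≡0) , (j , xsj≡w)) =
    (xs≤w ∘ (π ⟨$⟩ʳ_)) ,
    (π ⟨$⟩ˡ i , trans (cong xs (Perm.inverseʳ π)) xsi≡0) ,
    (π ⟨$⟩ˡ j , trans (cong xs (Perm.inverseʳ π)) xsj≡w)

  infix 4 _⇝_

  record _⇝_ (xs xs′ : Fin 4 → ℕ) : Set where
    constructor move
    field
      permutation : Permutation′ 4
      equivalence : ∀ ys → FourEquiv (grid xs ys) (grid xs′ (ys ∘ (permutation ⟨$⟩ʳ_)))

  ⇝-trans : ∀ {xs xs′ xs″} → xs ⇝ xs′ → xs′ ⇝ xs″ → xs ⇝ xs″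
  ⇝-trans {xs″ = xs″} (move π xs~xs′) (move σ xs′~xs″) =
    move (σ ∘ₚ π) λ ys →
      FourEquiv-trans {U = grid xs″ (ys ∘ (π ⟨$⟩ʳ_) ∘ (σ ⟨$⟩ʳ_))} (xs~xs′ ys) (xs′~xs″ (ys ∘ (π ⟨$⟩ʳ_)))

  ⇝-permute : ∀ xs π → xs ⇝ xs ∘ (π ⟨$⟩ʳ_)
  ⇝-permute xs π = move π λ ys → FourEquiv-permute (grid xs ys) π

  ⇝-reflect : ∀ {w} xs → (∀ i → xs i ≤ w) → xs ⇝ (w ∸_) ∘ xs
  ⇝-reflect xs xs≤w = move Perm.id λ ys → grid-reflectˣ xs ys xs≤w

  ⇝-pointwise : ∀ {xs xs′} → (∀ i → xs i ≡ xs′ i) → xs ⇝ xs′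
  ⇝-pointwise xs≗xs′ = move Perm.id λ ys → FourEquiv-pointwise (λ i → cong (λ x → (+ x , + ys i)) (xs≗xs′ i))

  normalX : ℕ → ℕ → ℕ → Fin 4 → ℕ
  normalX w a b = lookup (0 ∷ w ∷ a ∷ b ∷ [])

  XNormalForm : ℕ → (Fin 4 → ℕ) → Set
  XNormalForm w xs = ∃₂ λ a b → (a , b) ∈ pairs w × xs ⇝ normalX w a b

  XNormalForm-⇝ : ∀ {w xs xs′} → xs ⇝ xs′ → XNormalForm w xs′ → XNormalForm w xs
  XNormalForm-⇝ xs⇝xs′ (a , b , ab∈ , xs′⇝) = a , b , ab∈ , ⇝-trans xs⇝xs′ xs′⇝

  sort-last-two : ∀ {w} xs → xs 0F ≡ 0 → xs 1F ≡ w → xs 2F + xs 3F ≤ w → XNormalForm w xs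
  sort-last-two {w} xs x₀≡0 x₁≡w sum≤w with xs 2F ≤? xs 3F
  ... | yes x₂≤x₃ = xs 2F , xs 3F , ∈-pairs w x₂≤x₃ sum≤w ,
    ⇝-pointwise λ { 0F → x₀≡0 ; 1F → x₁≡w ; 2F → refl ; 3F → refl }
  ... | no x₂≰x₃ =
    xs 3F , xs 2F , ∈-pairs w (<⇒≤ (≰⇒> x₂≰x₃)) (subst (_≤ w) (+-comm (xs 2F) (xs 3F)) sum≤w) ,
    ⇝-trans (⇝-permute xs (transpose 2F 3F))
            (⇝-pointwise λ { 0F → x₀≡0 ; 1F → x₁≡w ; 2F → refl ; 3F → refl })

  reflected-sum≤ : ∀ {w x y} → x ≤ w → y ≤ w → ¬ (x + y ≤ w) → (w ∸ x) + (w ∸ y) ≤ w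
  reflected-sum≤ {w} {x} {y} x≤w y≤w x+y≰w =
    ≤-trans (+-monoʳ-≤ (w ∸ x) w∸y≤x) (≤-reflexive (m∸n+n≡m x≤w))
    where
    w∸y≤x : w ∸ y ≤ x
    w∸y≤x = m≤n+o⇒m∸n≤o w y (subst (w ≤_) (+-comm x y) (<⇒≤ (≰⇒> x+y≰w)))

  balance : ∀ {w} xs → (∀ i → xs i ≤ w) → xs 0F ≡ 0 → xs 1F ≡ w → XNormalForm w xs
  balance {w} xs xs≤w x₀≡0 x₁≡w with xs 2F + xs 3F ≤? w
  ... | yes sum≤w = sort-last-two xs x₀≡0 x₁≡w sum≤w
  ... | no sum≰w = XNormalForm-⇝ (⇝-trans (⇝-reflect xs xs≤w) (⇝-permute xs′ (transpose 0F 1F)))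
    (sort-last-two (xs′ ∘ (transpose 0F 1F ⟨$⟩ʳ_)) (trans (cong (w ∸_) x₁≡w) (n∸n≡0 w)) (cong (w ∸_) x₀≡0)
                   (reflected-sum≤ (xs≤w 2F) (xs≤w 3F) sum≰w))
    where
    xs′ : Fin 4 → ℕ
    xs′ = (w ∸_) ∘ xs

  to-front : Fin 4 → Fin 4 → Permutation′ 4
  to-front i j = transpose 1F (transpose 0F i ⟨$⟩ʳ j) ∘ₚ transpose 0F i

  to-front-sends : ∀ i j → i ≢ j → to-front i j ⟨$⟩ʳ 0F ≡ i × to-front i j ⟨$⟩ʳ 1F ≡ j
  to-front-sends 0F 0F i≢j = ⊥-elim (i≢j refl)
  to-front-sends 0F 1F _ = refl , refl
  to-front-sends 0F 2F _ = refl , refl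
  to-front-sends 0F 3F _ = refl , refl
  to-front-sends 1F 0F _ = refl , refl
  to-front-sends 1F 1F i≢j = ⊥-elim (i≢j refl)
  to-front-sends 1F 2F _ = refl , refl
  to-front-sends 1F 3F _ = refl , refl
  to-front-sends 2F 0F _ = refl , refl
  to-front-sends 2F 1F _ = refl , refl
  to-front-sends 2F 2F i≢j = ⊥-elim (i≢j refl)
  to-front-sends 2F 3F _ = refl , refl
  to-front-sends 3F 0F _ = refl , refl
  to-front-sends 3F 1F _ = refl , refl
  to-front-sends 3F 2F _ = refl , refl
  to-front-sends 3F 3F i≢j = ⊥-elim (i≢j refl)

  distinct : Fin 4 → Fin 4
  distinct 0F = 1F
  distinct _ = 0F

  distinct-≢ : ∀ i → i ≢ distinct i
  distinct-≢ 0F ()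
  distinct-≢ 1F ()
  distinct-≢ 2F ()
  distinct-≢ 3F ()

  endpoints-first : ∀ {w} xs → Fills w xs → ∃ λ π → xs (π ⟨$⟩ʳ 0F) ≡ 0 × xs (π ⟨$⟩ʳ 1F) ≡ w
  endpoints-first {w} xs (xs≤w , (i , xsi≡0) , (j , xsj≡w)) = to-front-of maximum-elsewhere
    where
    maximum-elsewhere : ∃ λ j′ → i ≢ j′ × xs j′ ≡ w
    maximum-elsewhere with i Fin.≟ j
    ... | no i≢j = j , i≢j , xsj≡w
    ... | yes refl = distinct i , distinct-≢ i ,
      trans (n≤0⇒n≡0 (subst (xs (distinct i) ≤_) w≡0 (xs≤w (distinct i)))) (sym w≡0)
      where
      w≡0 : w ≡ 0
      w≡0 = trans (sym xsj≡w) xsi≡0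
    to-front-of : (∃ λ j′ → i ≢ j′ × xs j′ ≡ w) →
      ∃ λ π → xs (π ⟨$⟩ʳ 0F) ≡ 0 × xs (π ⟨$⟩ʳ 1F) ≡ w
    to-front-of (j′ , i≢j′ , xsj′≡w) with to-front-sends i j′ i≢j′
    ... | π0≡i , π1≡j′ = to-front i j′ , trans (cong xs π0≡i) xsi≡0 , trans (cong xs π1≡j′) xsj′≡w

  x-normalise : ∀ {w} xs → Fills w xs → XNormalForm w xs
  x-normalise xs fills@(xs≤w , _) with endpoints-first xs fills
  ... | π , x₀≡0 , x₁≡w =
    XNormalForm-⇝ (⇝-permute xs π) (balance (xs ∘ (π ⟨$⟩ʳ_)) (xs≤w ∘ (π ⟨$⟩ʳ_)) x₀≡0 x₁≡w)

  YNormalForm : ℕ → (Fin 4 → ℕ) → Set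
  YNormalForm n ys = ∃ λ t → t ∈ profiles n 4 × ∀ xs → FourEquiv (grid xs ys) (grid xs (lookup t))

  y-normalise : ∀ {n} ys → Fills n ys → YNormalForm n ys
  y-normalise {n} ys (ys≤n , (i , ysi≡0) , (j , ysj≡n))
    with profiles-complete-4 n (tabulate⁺ ys≤n) (subst (_∈ᵥ tabulate ys) ysi≡0 (∈-tabulate⁺ ys i))
                               (subst (_∈ᵥ tabulate ys) ysj≡n (∈-tabulate⁺ ys j))
  ... | inj₁ t∈ = tabulate ys , t∈ , λ xs →
    FourEquiv-pointwise λ k → cong (λ y → (+ xs k , + y)) (sym (lookup∘tabulate ys k))
  ... | inj₂ t∈ = reflect n (tabulate ys) , t∈ , λ xs →
    FourEquiv-trans {T = grid xs (λ k → n ∸ ys k)} {U = grid xs (lookup (reflect n (tabulate ys)))}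
      (grid-reflectʸ xs ys ys≤n)
    (FourEquiv-pointwise λ k → cong (λ y → (+ xs k , + y))
      (sym (trans (lookup-map k (n ∸_) (tabulate ys)) (cong (n ∸_) (lookup∘tabulate ys k)))))

module Coordinates where
  open import Data.Nat as ℕ using (ℕ)
  open import Data.Integer using (ℤ; +_; _-_; -_; _≤_; 1ℤ; ∣_∣)
  open import Data.Integer.Properties
  open Width
  open UnimodularBasis
  open Equivalence
  open NormalForms

  offsets : ∀ u S {w} → width u S ≡ + w →
    ∃ λ xs → (∀ i → + xs i ≡ dot u (S i) - min4 (λ k → dot u (S k))) × Fills w xs
  offsets u S {w} width≡w = xs , +xs≡ , xs≤w , at-minimum , at-maximum
    where
    f : Fin 4 → ℤ
    f k = dot u (S k)
    xs : Fin 4 → ℕ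
    xs i = ∣ f i - min4 f ∣
    +xs≡ : ∀ i → + xs i ≡ f i - min4 f
    +xs≡ i = 0≤i⇒+∣i∣≡i (i≤j⇒0≤j-i (min4-lowerBound f i))
    xs≤w : ∀ i → xs i ℕ.≤ w
    xs≤w i = drop‿+≤+ (≤-trans (≤-reflexive (+xs≡ i))
      (≤-trans (+-monoˡ-≤ (- min4 f) (max4-upperBound f i)) (≤-reflexive width≡w)))
    at-minimum : ∃ λ i → xs i ≡ 0
    at-minimum with min4-attained f
    ... | i , min≡fi = i , cong ∣_∣ (trans (cong (λ m → f i - m) min≡fi) (+-inverseʳ (f i)))
    at-maximum : ∃ λ i → xs i ≡ w
    at-maximum with max4-attained f
    ... | i , max≡fi = i , cong ∣_∣ (trans (cong (_- min4 f) (sym max≡fi)) width≡w)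

  grid-coordinates : ∀ {S p v w₁ w₂} → det p v ≡ 1ℤ → width p S ≡ + w₁ → width v S ≡ + w₂ →
    ∃₂ λ xs ys → FourEquiv S (grid xs ys) × Fills w₁ xs × Fills w₂ ys
  grid-coordinates {S} {p} {v} pv≡1 width-p width-v with offsets p S width-p | offsets v S width-v
  ... | xs , +xs≡ , xs-fills | ys , +ys≡ , ys-fills =
    xs , ys , FourEquiv-affine (p , v) (- min4 (λ k → dot p (S k)) , - min4 (λ k → dot v (S k))) (inj₁ pv≡1)
                (λ i → cong₂ _,_ (sym (+xs≡ i)) (sym (+ys≡ i))) ,
    xs-fills , ys-fills

  LexLe-antisym : ∀ {a b c d} → LexLe (a , b) (c , d) → c ≤ a → d ≤ b → c ≡ a × d ≡ b
  LexLe-antisym (inj₁ a<c) c≤a _ = ⊥-elim (<-irrefl refl (<-≤-trans a<c c≤a))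
  LexLe-antisym (inj₂ (a≡c , b≤d)) _ d≤b = sym a≡c , ≤-antisym d≤b b≤d

  minimal-basis : ∀ {S w₁ w₂} → w₁ ℕ.≤ w₂ → HasMultiWidth S w₁ w₂ →
    ∃₂ λ p v → det p v ≡ 1ℤ × width p S ≡ + w₁ × width v S ≡ + w₂
  minimal-basis {S} w₁≤w₂ ((u₁ , u₂ , indep , width-u₁ , width-u₂) , minimal) =
    let p , v , pv≡1 , p≤w₁ , v≤w₂ = unimodular-basis {S} {u₁} {u₂} indep w₁≤w₂
          (subst (WidthAtMost u₁ S) width-u₁ (width-atMost u₁ S))
          (subst (WidthAtMost u₂ S) width-u₂ (width-atMost u₂ S))
    in p , v , pv≡1 , LexLe-antisym (minimal p v (det≡1⇒independent p v pv≡1))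
                        (atMost⇒width≤ {p} {S} p≤w₁) (atMost⇒width≤ {v} {S} v≤w₂)
    where
    det≡1⇒independent : ∀ p v → det p v ≡ 1ℤ → LinIndep p v
    det≡1⇒independent p v pv≡1 pv≡0 with trans (sym pv≡1) pv≡0
    ... | ()

module Representatives where
  open import Data.Nat using (ℕ; _+_; _*_; _≤_)
  open import Data.Nat.Properties using (*-assoc)
  open import Data.Fin.Permutation using (_⟨$⟩ʳ_)
  open import Data.Vec using (Vec; lookup)
  open import Data.List using (List; length; cartesianProductWith)
  open import Data.List.Relation.Unary.Any as Any using (Any)
  open import Data.List.Membership.Propositional using (lose)
  open import Data.List.Membership.Propositional.Properties using (∈-cartesianProductWith⁺)
  open Equivalence
  open Pairs
  open Profiles
  open NormalForms
  open Coordinates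

  representative : ℕ → ℕ × ℕ → Vec ℕ 4 → FourSet
  representative w (a , b) t = grid (normalX w a b) (lookup t)

  representatives : ℕ → ℕ → List FourSet
  representatives w₁ w₂ = cartesianProductWith (representative w₁) (pairs w₁) (profiles w₂ 4)

  length-representatives : ∀ w₁ w₂ →
    4 * length (representatives w₁ w₂) ≡ (w₁ * w₁ + 4 * w₁ + fourC w₁) * (6 * (w₂ * w₂) + 1)
  length-representatives w₁ w₂ = begin
    4 * length (representatives w₁ w₂)
      ≡⟨ cong (4 *_) (length-cartesianProductWith (representative w₁) (pairs w₁) (profiles w₂ 4)) ⟩
    4 * (length (pairs w₁) * length (profiles w₂ 4))
      ≡⟨ *-assoc 4 (length (pairs w₁)) (length (profiles w₂ 4)) ⟨
    4 * length (pairs w₁) * length (profiles w₂ 4)       ≡⟨ cong₂ _*_ (length-pairs w₁) (length-profiles-4 w₂) ⟩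
    (w₁ * w₁ + 4 * w₁ + fourC w₁) * (6 * (w₂ * w₂) + 1) ∎
    where open ≡-Reasoning

  grid-cover : ∀ {w₁ w₂} xs ys → Fills w₁ xs → Fills w₂ ys →
    Any (FourEquiv (grid xs ys)) (representatives w₁ w₂)
  grid-cover {w₁} {w₂} xs ys xs-fills ys-fills = case x-normalise xs xs-fills of λ where
    (a , b , ab∈pairs , move π xs⇝normal) →
      case y-normalise (ys ∘ (π ⟨$⟩ʳ_)) (Fills-permute π ys-fills) of λ where
        (t , t∈profiles , ys⇝profile) →
          lose (∈-cartesianProductWith⁺ (representative w₁) ab∈pairs t∈profiles)
            (FourEquiv-trans {grid xs ys} {grid (normalX w₁ a b) (ys ∘ (π ⟨$⟩ʳ_))} {representative w₁ (a , b) t}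
              (xs⇝normal ys) (ys⇝profile (normalX w₁ a b)))

  representatives-cover : ∀ {w₁ w₂ S} → w₁ ≤ w₂ → HasMultiWidth S w₁ w₂ →
    Any (FourEquiv S) (representatives w₁ w₂)
  representatives-cover {w₁} {w₂} {S} w₁≤w₂ has-multi-width =
    case minimal-basis {S} {w₁} {w₂} w₁≤w₂ has-multi-width of λ where
      (p , v , pv≡1 , width-p , width-v) → case grid-coordinates {S} {p} {v} pv≡1 width-p width-v of λ where
        (xs , ys , S~grid , xs-fills , ys-fills) →
          Any.map (λ {T} → FourEquiv-trans {S} {grid xs ys} {T} S~grid) (grid-cover xs ys xs-fills ys-fills)

open import Data.Nat using (ℕ; _+_; _*_; _≤_)
open import Data.Nat.Properties using (≤-reflexive)
open import Data.List using (List; length)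
open import Data.List.Relation.Unary.Any using (Any)
open Representatives

proposition5p1 : (w₁ w₂ : ℕ) → w₁ ≤ w₂ →
    Σ (List FourSet) (λ L →
      (4 * length L ≤ (w₁ * w₁ + 4 * w₁ + fourC w₁) * (6 * (w₂ * w₂) + 1))
      × ((S : FourSet) → HasMultiWidth S w₁ w₂ → Any (λ T → FourEquiv S T) L))
proposition5p1 w₁ w₂ w₁≤w₂ =
  representatives w₁ w₂ , ≤-reflexive (length-representatives w₁ w₂) , λ S → representatives-cover w₁≤w₂
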